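{- Let $H$ be a minimal counterexample to the statement that every crown-free linear $3$-graph on $n$ vertices has at most $\frac{3n}{2}$ edges, i.e. $H$ is a crown-free linear $3$-graph on $n$ vertices with $|E(H)| > \frac{3n}{2}$, and $n$ is as small as possible among all such $3$-graphs. Then $H$ contains no edge $e=\{a,b,c\}$ with $d(a)=d(b)=4$, $d(c)=3$ whose link graph $G(e)$ is the following coloured graph $G_6$: $G_6$ is the vertex-disjoint union of two $4$-cycles, where the edges of the first $4$-cycle, in cyclic order, have colours $a, c, b, c$, and the edges of the second $4$-cycle, in cyclic order, have colours $a, b, a, b$.
   Context: A (linear) $3$-graph $H=(V,E)$ consists of a finite vertex set $V$ and a set $E$ of $3$-element subsets of $V$ (edges) such that any two distinct edges intersect in at most one vertex; $d(v)$ is the number of edges containing $v$. A crown is the $3$-graph consisting of three pairwise disjoint edges together with a fourth edge intersecting each of them; $H$ is crown-free if no four edges of $H$ form a crown. For an edge $e=\{a,b,c\}$, the link graph $G(e)$ is the graph whose edges are the pairs $\{x,y\}$ for which there is an edge $\{x,y,z\} \in E(H)$ with $z \in \{a,b,c\}$; its vertex set is the set of vertices covered by these pairs; the edge $\{x,y\}$ gets colour $z$. -}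

module Defs where

open import Data.Nat using (ℕ; _*_; _<_)
open import Data.Fin using (Fin; _≟_)
import Data.Fin as F
open import Data.Product using (_×_; _,_; Σ; ∃; ∃-syntax)
open import Data.Sum using (_⊎_)
open import Data.List using (List; []; _∷_; length; filter)
open import Data.List.Membership.Propositional using (_∈_)
open import Data.List.Relation.Unary.All using (All)
open import Data.List.Relation.Unary.Unique.Propositional using (Unique)
open import Relation.Binary.PropositionalEquality using (_≡_)
open import Relation.Nullary using (¬_; Dec)
open import Relation.Nullary.Decidable using (_⊎-dec_)
open import Function using (_⇔_)

-- A 3-element subset {x,y,z} of Fin n is represented canonically by the
-- sorted triple (x , y , z) with x < y < z.
Triple : ℕ → Set
Triple n = Fin n × Fin n × Fin n

Sorted : ∀ {n} → Triple n → Set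
Sorted (x , y , z) = (x F.< y) × (y F.< z)

_∈ₑ_ : ∀ {n} → Fin n → Triple n → Set
v ∈ₑ (x , y , z) = (v ≡ x) ⊎ (v ≡ y) ⊎ (v ≡ z)

_∈ₑ?_ : ∀ {n} (v : Fin n) (t : Triple n) → Dec (v ∈ₑ t)
v ∈ₑ? (x , y , z) = (v ≟ x) ⊎-dec ((v ≟ y) ⊎-dec (v ≟ z))

record ThreeGraph (n : ℕ) : Set where
  field
    edges  : List (Triple n)
    sorted : All Sorted edges
    unique : Unique edges
open ThreeGraph public

numEdges : ∀ {n} → ThreeGraph n → ℕ
numEdges H = length (edges H)

deg : ∀ {n} → ThreeGraph n → Fin n → ℕ
deg H v = length (filter (v ∈ₑ?_) (edges H))

ShareTwo : ∀ {n} → Triple n → Triple n → Set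
ShareTwo e f = ∃[ u ] ∃[ v ] (¬ u ≡ v × u ∈ₑ e × v ∈ₑ e × u ∈ₑ f × v ∈ₑ f)

Linear : ∀ {n} → ThreeGraph n → Set
Linear H = ∀ e f → e ∈ edges H → f ∈ edges H → ¬ e ≡ f → ¬ ShareTwo e f

Disjoint : ∀ {n} → Triple n → Triple n → Set
Disjoint e f = ∀ v → v ∈ₑ e → ¬ v ∈ₑ f

Meets : ∀ {n} → Triple n → Triple n → Set
Meets e f = ∃[ v ] (v ∈ₑ e × v ∈ₑ f)

HasCrown : ∀ {n} → ThreeGraph n → Set
HasCrown H = ∃[ e₁ ] ∃[ e₂ ] ∃[ e₃ ] ∃[ e₄ ]
  ( e₁ ∈ edges H × e₂ ∈ edges H × e₃ ∈ edges H × e₄ ∈ edges H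
  × Disjoint e₁ e₂ × Disjoint e₁ e₃ × Disjoint e₂ e₃
  × Meets e₄ e₁ × Meets e₄ e₂ × Meets e₄ e₃ )

CrownFree : ∀ {n} → ThreeGraph n → Set
CrownFree H = ¬ HasCrown H

-- H is a counterexample: crown-free linear with |E| > 3n/2, i.e. 2|E| > 3n
Counterexample : ∀ {n} → ThreeGraph n → Set
Counterexample {n} H = Linear H × CrownFree H × (3 * n < 2 * numEdges H)

MinimalCounterexample : ∀ {n} → ThreeGraph n → Set
MinimalCounterexample {n} H =
  Counterexample H × (∀ m → m < n → (H' : ThreeGraph m) → ¬ Counterexample H')

-- Link graph of e: {x,y} is an edge of colour z iff there is an edge f ≠ e of H
-- with f = {x,y,z} and z ∈ e.
LinkEdge : ∀ {n} → ThreeGraph n → Triple n → Fin n → Fin n → Fin n → Set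
LinkEdge H e x y z = z ∈ₑ e × ∃[ f ] ( f ∈ edges H × ¬ f ≡ e
  × x ∈ₑ f × y ∈ₑ f × z ∈ₑ f × ¬ x ≡ y × ¬ x ≡ z × ¬ y ≡ z )

G6Edges : ∀ {n} (a b c u₁ u₂ u₃ u₄ w₁ w₂ w₃ w₄ : Fin n) → List (Triple n)
G6Edges a b c u₁ u₂ u₃ u₄ w₁ w₂ w₃ w₄ =
  (u₁ , u₂ , a) ∷ (u₂ , u₃ , c) ∷ (u₃ , u₄ , b) ∷ (u₄ , u₁ , c) ∷
  (w₁ , w₂ , a) ∷ (w₂ , w₃ , b) ∷ (w₃ , w₄ , a) ∷ (w₄ , w₁ , b) ∷ []

-- G(e) is (isomorphic to) G₆ w.r.t. the colour names a, b, c: there are 8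
-- distinct vertices forming the two 4-cycles such that the coloured edges of
-- G(e) are exactly those of G₆ (as unordered pairs).
LinkIsG6 : ∀ {n} → ThreeGraph n → Triple n → (a b c : Fin n) → Set
LinkIsG6 H e a b c = ∃[ u₁ ] ∃[ u₂ ] ∃[ u₃ ] ∃[ u₄ ] ∃[ w₁ ] ∃[ w₂ ] ∃[ w₃ ] ∃[ w₄ ]
  ( Unique (u₁ ∷ u₂ ∷ u₃ ∷ u₄ ∷ w₁ ∷ w₂ ∷ w₃ ∷ w₄ ∷ [])
  × (∀ x y z → LinkEdge H e x y z ⇔
       ((x , y , z) ∈ G6Edges a b c u₁ u₂ u₃ u₄ w₁ w₂ w₃ w₄
        ⊎ (y , x , z) ∈ G6Edges a b c u₁ u₂ u₃ u₄ w₁ w₂ w₃ w₄)) )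

BadEdge : ∀ {n} → ThreeGraph n → Set
BadEdge H = ∃[ e ] ∃[ a ] ∃[ b ] ∃[ c ]
  ( e ∈ edges H × a ∈ₑ e × b ∈ₑ e × c ∈ₑ e
  × ¬ a ≡ b × ¬ a ≡ c × ¬ b ≡ c
  × deg H a ≡ 4 × deg H b ≡ 4 × deg H c ≡ 3
  × LinkIsG6 H e a b c )

{-# OPTIONS --safe #-}
-- Let S be the eleven vertices of e and of its link graph G(e) ≅ G₆. An edge meeting S that
-- shares two vertices with e or with one of the eight edges {x,y,z} realising G(e) is that edge,
-- by linearity; one containing a diagonal pair of the two 4-cycles is, again by linearity, unique
-- for that diagonal; and any other edge meeting S would complete a crown with three of those nine
-- edges, a finite check over the possible traces of an edge on S, done by evaluation. So at most
-- 9 + 4 = 13 edges meet S, and deleting S leaves a linear crown-free 3-graph on n − 11 vertices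
-- with more than 3(n − 11)/2 edges because 2 · 13 ≤ 3 · 11, contradicting minimality.
module Submission where

open import Defs
open import Data.Nat using (ℕ)
open import Relation.Nullary using (¬_)

open import Data.Bool using (Bool; true; false; T; not; _∧_; _∨_)
open import Data.Bool.ListAction using (any)
open import Data.Bool.Properties using (T-∧; T-∨)
open import Data.Empty using (⊥-elim)
open import Data.Fin as Fin using (Fin; zero; suc; punchIn; punchOut; _≟_; join; splitAt; #_)
import Data.Fin.Properties as Fin
open import Data.List as List using (List; []; _∷_; _++_; length; filter; lookup; allFin)
open import Data.List.Membership.Propositional using (_∈_)
open import Data.List.Membership.Propositional.Properties using (∈-lookup; ∈-filter⁻; ∈-allFin)
open import Data.List.Properties using (filter-accept; filter-reject)
open import Data.List.Relation.Unary.All as All using (All; []; _∷_)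
import Data.List.Relation.Unary.All.Properties as All
open import Data.List.Relation.Unary.AllPairs using ([]; _∷_)
open import Data.List.Relation.Unary.Any as Any using (Any; here; there; any?)
import Data.List.Relation.Unary.Any.Properties as Any
open import Data.List.Relation.Unary.Unique.Propositional using (Unique)
import Data.List.Relation.Unary.Unique.Propositional.Properties as Unique
open import Data.Nat as ℕ using (zero; suc; _+_; _*_; _≤_; _<_; z≤n; s≤s)
import Data.Nat.Properties as ℕ
open import Data.Product using (∃-syntax; ∃₂; _×_; _,_; proj₁; proj₂)
open import Data.Product.Properties using (≡-dec; ×-≡,≡←≡)
open import Data.Sum as Sum using (_⊎_; inj₁; inj₂)
open import Data.Vec as Vec using (Vec; []; _∷_)
import Data.Vec.Properties as Vec
open import Function using (_∘_; _⇔_; mk⇔; Equivalence; Injective)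
open import Relation.Binary.PropositionalEquality
open import Relation.Nullary using (Dec; yes; no; contradiction)
open import Relation.Nullary.Decidable
  using (⌊_⌋; ¬?; _×-dec_; _⊎-dec_; _→-dec_; from-yes; toWitness; fromWitness; decidable-stable)
open import Relation.Unary using (Decidable)

Distinct : ∀ {n} → Triple n → Set
Distinct (p , q , r) = p ≢ q × p ≢ r × q ≢ r

_⊆ₑ_ : ∀ {n} → Triple n → Triple n → Set
s ⊆ₑ t = ∀ {w} → w ∈ₑ s → w ∈ₑ t

position : ∀ {n} {v : Fin n} {t : Triple n} → v ∈ₑ t → Fin 3
position (inj₁ _)        = zero
position (inj₂ (inj₁ _)) = suc zero
position (inj₂ (inj₂ _)) = suc (suc zero)

position-injective : ∀ {n} {v w : Fin n} {t : Triple n} (p : v ∈ₑ t) (q : w ∈ₑ t) →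
                     position p ≡ position q → v ≡ w
position-injective (inj₁ p)        (inj₁ q)        _ = trans p (sym q)
position-injective (inj₂ (inj₁ p)) (inj₂ (inj₁ q)) _ = trans p (sym q)
position-injective (inj₂ (inj₂ p)) (inj₂ (inj₂ q)) _ = trans p (sym q)
position-injective (inj₁ _)        (inj₂ (inj₁ _)) ()
position-injective (inj₁ _)        (inj₂ (inj₂ _)) ()
position-injective (inj₂ (inj₁ _)) (inj₁ _)        ()
position-injective (inj₂ (inj₁ _)) (inj₂ (inj₂ _)) ()
position-injective (inj₂ (inj₂ _)) (inj₁ _)        ()
position-injective (inj₂ (inj₂ _)) (inj₂ (inj₁ _)) ()

-- Facts decided by evaluation are kept opaque: otherwise unification may unfold the decision
-- procedure behind them, which is very slow.
opaque
  three-distinct-cover : (i j k l : Fin 3) → i ≢ j → i ≢ k → j ≢ k → l ≡ i ⊎ l ≡ j ⊎ l ≡ k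
  three-distinct-cover =
    from-yes (Fin.all? {3} λ i → Fin.all? {3} λ j → Fin.all? {3} λ k → Fin.all? {3} λ l →
      ¬? (i ≟ j) →-dec ¬? (i ≟ k) →-dec ¬? (j ≟ k) →-dec (l ≟ i ⊎-dec l ≟ j ⊎-dec l ≟ k))

⊆ₑ-reverse : ∀ {n} {s t : Triple n} → Distinct s → s ⊆ₑ t → t ⊆ₑ s
⊆ₑ-reverse {s = p , q , r} (p≢q , p≢r , q≢r) s⊆t w∈t =
  Sum.map (same w∈t p∈t) (Sum.map (same w∈t q∈t) (same w∈t r∈t))
    (three-distinct-cover (position p∈t) (position q∈t) (position r∈t) (position w∈t)
      (p≢q ∘ same p∈t q∈t) (p≢r ∘ same p∈t r∈t) (q≢r ∘ same q∈t r∈t))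
  where
  p∈t = s⊆t (inj₁ refl)
  q∈t = s⊆t (inj₂ (inj₁ refl))
  r∈t = s⊆t (inj₂ (inj₂ refl))
  same = position-injective

⊆ₑ-intro : ∀ {n} {p q r : Fin n} {t} → p ∈ₑ t → q ∈ₑ t → r ∈ₑ t → (p , q , r) ⊆ₑ t
⊆ₑ-intro p∈ q∈ r∈ (inj₁ refl)        = p∈
⊆ₑ-intro p∈ q∈ r∈ (inj₂ (inj₁ refl)) = q∈
⊆ₑ-intro p∈ q∈ r∈ (inj₂ (inj₂ refl)) = r∈

map₃ : ∀ {m n} → (Fin m → Fin n) → Triple m → Triple n
map₃ φ (p , q , r) = φ p , φ q , φ r

map₃-∈⁺ : ∀ {m n} (φ : Fin m → Fin n) {k t} → k ∈ₑ t → φ k ∈ₑ map₃ φ t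
map₃-∈⁺ φ = Sum.map (cong φ) (Sum.map (cong φ) (cong φ))

map₃-∈⁻ : ∀ {m n} (φ : Fin m → Fin n) {w} t → w ∈ₑ map₃ φ t → ∃[ k ] k ∈ₑ t × w ≡ φ k
map₃-∈⁻ φ (p , q , r) (inj₁ w≡)        = p , inj₁ refl , w≡
map₃-∈⁻ φ (p , q , r) (inj₂ (inj₁ w≡)) = q , inj₂ (inj₁ refl) , w≡
map₃-∈⁻ φ (p , q , r) (inj₂ (inj₂ w≡)) = r , inj₂ (inj₂ refl) , w≡

map₃-distinct : ∀ {m n} {φ : Fin m → Fin n} → Injective _≡_ _≡_ φ → ∀ {t} → Distinct t → Distinct (map₃ φ t)
map₃-distinct φ-injective (p≢q , p≢r , q≢r) = p≢q ∘ φ-injective , p≢r ∘ φ-injective , q≢r ∘ φ-injective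

_≟ₜ_ : ∀ {n} → (s t : Triple n) → Dec (s ≡ t)
_≟ₜ_ = ≡-dec _≟_ (≡-dec _≟_ _≟_)

module _ {n} {H : ThreeGraph n} (linear : Linear H) where

  shareTwo⇒≡ : ∀ {f g u w} → f ∈ edges H → g ∈ edges H → u ≢ w →
               u ∈ₑ f → w ∈ₑ f → u ∈ₑ g → w ∈ₑ g → f ≡ g
  shareTwo⇒≡ {f} {g} f∈ g∈ u≢w u∈f w∈f u∈g w∈g = decidable-stable (f ≟ₜ g)
    λ f≢g → linear f g f∈ g∈ f≢g (_ , _ , u≢w , u∈f , w∈f , u∈g , w∈g)

  linkEdge-ends∉ : ∀ {e x y z} → e ∈ edges H → LinkEdge H e x y z → ¬ x ∈ₑ e × ¬ y ∈ₑ e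
  linkEdge-ends∉ e∈ (z∈e , f , f∈ , f≢e , x∈f , y∈f , z∈f , _ , x≢z , y≢z) =
    (λ x∈e → linear f _ f∈ e∈ f≢e (_ , _ , x≢z , x∈f , z∈f , x∈e , z∈e)) ,
    (λ y∈e → linear f _ f∈ e∈ f≢e (_ , _ , y≢z , y∈f , z∈f , y∈e , z∈e))

EdgeOver : ∀ {n} → ThreeGraph n → Triple n → Set
EdgeOver H t = ∃[ f ] (f ∈ edges H × t ⊆ₑ f)

linkEdge⇒edgeOver : ∀ {n} {H : ThreeGraph n} {e x y z} → LinkEdge H e x y z → EdgeOver H (x , y , z)
linkEdge⇒edgeOver (_ , f , f∈ , _ , x∈ , y∈ , z∈ , _) = f , f∈ , ⊆ₑ-intro x∈ y∈ z∈

-- Deleting vertices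

module _ {X : Set} {P : X → Set} (P? : Decidable P) {x : X} {xs : List X} where

  length-accept : P x → length (filter P? (x ∷ xs)) ≡ suc (length (filter P? xs))
  length-accept = cong length ∘ filter-accept P?

  length-reject : ¬ P x → length (filter P? (x ∷ xs)) ≡ length (filter P? xs)
  length-reject = cong length ∘ filter-reject P?

module _ {m : ℕ} (v : Fin (suc m)) where

  squeeze : (t : Triple (suc m)) → ¬ v ∈ₑ t → Triple m
  squeeze (x , y , z) v∉ = punchOut (v∉ ∘ inj₁) , punchOut (v∉ ∘ inj₂ ∘ inj₁) , punchOut (v∉ ∘ inj₂ ∘ inj₂)

  squeeze-∈⁺ : ∀ t v∉ {w} (v≢w : v ≢ w) → w ∈ₑ t → punchOut v≢w ∈ₑ squeeze t v∉
  squeeze-∈⁺ (x , y , z) v∉ v≢w =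
    Sum.map (Fin.punchOut-cong v) (Sum.map (Fin.punchOut-cong v) (Fin.punchOut-cong v))

  squeeze-∈⁻ : ∀ t v∉ {u} → u ∈ₑ squeeze t v∉ → punchIn v u ∈ₑ t
  squeeze-∈⁻ (x , y , z) v∉ = Sum.map punchIn-≡ (Sum.map punchIn-≡ punchIn-≡)
    where
    punchIn-≡ : ∀ {u w} {v≢w : v ≢ w} → u ≡ punchOut v≢w → punchIn v u ≡ w
    punchIn-≡ refl = Fin.punchIn-punchOut _

  squeeze-injective : ∀ t s v∉t v∉s → squeeze t v∉t ≡ squeeze s v∉s → t ≡ s
  squeeze-injective (x , y , z) (x′ , y′ , z′) v∉t v∉s eq =
    let x≡ , yz≡ = ×-≡,≡←≡ eq
        y≡ , z≡ = ×-≡,≡←≡ yz≡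
    in cong₂ _,_ (Fin.punchOut-injective (v∉t ∘ inj₁) (v∉s ∘ inj₁) x≡)
         (cong₂ _,_ (Fin.punchOut-injective (v∉t ∘ inj₂ ∘ inj₁) (v∉s ∘ inj₂ ∘ inj₁) y≡)
                    (Fin.punchOut-injective (v∉t ∘ inj₂ ∘ inj₂) (v∉s ∘ inj₂ ∘ inj₂) z≡))

  squeeze-cong : ∀ {t s} v∉t v∉s → t ≡ s → squeeze t v∉t ≡ squeeze s v∉s
  squeeze-cong {x , y , z} v∉t v∉s refl =
    cong₂ _,_ (irrelevant (v∉t ∘ inj₁) (v∉s ∘ inj₁))
      (cong₂ _,_ (irrelevant (v∉t ∘ inj₂ ∘ inj₁) (v∉s ∘ inj₂ ∘ inj₁))
                 (irrelevant (v∉t ∘ inj₂ ∘ inj₂) (v∉s ∘ inj₂ ∘ inj₂)))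
    where
    irrelevant : ∀ {w} (p q : v ≢ w) → punchOut p ≡ punchOut q
    irrelevant p q = Fin.punchOut-cong v refl

  squeeze-sorted : ∀ t v∉ → Sorted t → Sorted (squeeze t v∉)
  squeeze-sorted (x , y , z) v∉ (x<y , y<z) = punchOut-mono-< x<y , punchOut-mono-< y<z
    where
    punchOut-mono-< : ∀ {i j} {v≢i : v ≢ i} {v≢j : v ≢ j} → i Fin.< j → punchOut v≢i Fin.< punchOut v≢j
    punchOut-mono-< {v≢i = v≢i} {v≢j} i<j =
      Fin.≤∧≢⇒< (Fin.punchOut-mono-≤ v≢i v≢j (ℕ.<⇒≤ i<j)) (Fin.<⇒≢ i<j ∘ Fin.punchOut-injective v≢i v≢j)

  squeeze-disjoint⁻ : ∀ {s t} v∉s v∉t → Disjoint (squeeze s v∉s) (squeeze t v∉t) → Disjoint s t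
  squeeze-disjoint⁻ {s} {t} v∉s v∉t disjoint w w∈s w∈t =
    disjoint (punchOut v≢w) (squeeze-∈⁺ s v∉s v≢w w∈s) (squeeze-∈⁺ t v∉t v≢w w∈t)
    where
    v≢w : v ≢ w
    v≢w refl = v∉s w∈s

  squeeze-meets⁻ : ∀ {s t} v∉s v∉t → Meets (squeeze s v∉s) (squeeze t v∉t) → Meets s t
  squeeze-meets⁻ {s} {t} v∉s v∉t (u , u∈s , u∈t) = punchIn v u , squeeze-∈⁻ s v∉s u∈s , squeeze-∈⁻ t v∉t u∈t

  deleteEdges : List (Triple (suc m)) → List (Triple m)
  deleteEdges [] = []
  deleteEdges (t ∷ ts) with v ∈ₑ? t
  ... | yes _  = deleteEdges ts
  ... | no v∉ = squeeze t v∉ ∷ deleteEdges ts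

  deleteEdges-∈⁻ : ∀ ts {t′} → t′ ∈ deleteEdges ts → ∃₂ λ t v∉ → t ∈ ts × t′ ≡ squeeze t v∉
  deleteEdges-∈⁻ (t ∷ ts) t′∈ with v ∈ₑ? t | t′∈
  ... | yes _  | t′∈′        = let s , v∉ , s∈ , eq = deleteEdges-∈⁻ ts t′∈′ in s , v∉ , there s∈ , eq
  ... | no v∉ | here eq     = t , v∉ , here refl , eq
  ... | no _  | there t′∈′ = let s , v∉ , s∈ , eq = deleteEdges-∈⁻ ts t′∈′ in s , v∉ , there s∈ , eq

  deleteEdges-sorted : ∀ {ts} → All Sorted ts → All Sorted (deleteEdges ts)
  deleteEdges-sorted {[]}     []       = []
  deleteEdges-sorted {t ∷ ts} (s ∷ ss) with v ∈ₑ? t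
  ... | yes _  = deleteEdges-sorted ss
  ... | no v∉ = squeeze-sorted t v∉ s ∷ deleteEdges-sorted ss

  deleteEdges-unique : ∀ {ts} → Unique ts → Unique (deleteEdges ts)
  deleteEdges-unique {[]}     []         = []
  deleteEdges-unique {t ∷ ts} (t∉ ∷ uts) with v ∈ₑ? t
  ... | yes _  = deleteEdges-unique uts
  ... | no v∉ = All.tabulate fresh ∷ deleteEdges-unique uts
    where
    fresh : ∀ {t′} → t′ ∈ deleteEdges ts → squeeze t v∉ ≢ t′
    fresh t′∈ eq = let s , v∉s , s∈ , eq′ = deleteEdges-∈⁻ ts t′∈
                   in All.lookup t∉ s∈ (squeeze-injective t s v∉ v∉s (trans eq eq′))

  deleteEdges-length : ∀ ts → length (deleteEdges ts) + length (filter (v ∈ₑ?_) ts) ≡ length ts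
  deleteEdges-length [] = refl
  deleteEdges-length (t ∷ ts) with v ∈ₑ? t
  ... | yes v∈t = let open ≡-Reasoning in begin
    kept + length (filter (v ∈ₑ?_) (t ∷ ts)) ≡⟨ cong (kept +_) (length-accept (v ∈ₑ?_) v∈t) ⟩
    kept + suc (length (filter (v ∈ₑ?_) ts)) ≡⟨ ℕ.+-suc _ _ ⟩
    suc (kept + length (filter (v ∈ₑ?_) ts)) ≡⟨ cong suc (deleteEdges-length ts) ⟩
    suc (length ts)                           ∎
    where kept = length (deleteEdges ts)
  ... | no v∉t = cong suc (trans (cong (length (deleteEdges ts) +_) (length-reject (v ∈ₑ?_) v∉t))
                                 (deleteEdges-length ts))

delete : ∀ {m} → Fin (suc m) → ThreeGraph (suc m) → ThreeGraph m
delete v H = record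
  { edges  = deleteEdges v (edges H)
  ; sorted = deleteEdges-sorted v (sorted H)
  ; unique = deleteEdges-unique v (unique H)
  }

module _ {m : ℕ} (v : Fin (suc m)) (H : ThreeGraph (suc m)) where

  private
    preimage : ∀ {t′} → t′ ∈ edges (delete v H) → ∃₂ λ t v∉ → t ∈ edges H × t′ ≡ squeeze v t v∉
    preimage = deleteEdges-∈⁻ v (edges H)

  delete-linear : Linear H → Linear (delete v H)
  delete-linear linear e′ f′ e′∈ f′∈ e′≢f′ (u , w , u≢w , u∈e′ , w∈e′ , u∈f′ , w∈f′)
    with preimage e′∈ | preimage f′∈
  ... | e , v∉e , e∈ , refl | f , v∉f , f∈ , refl =
    linear e f e∈ f∈ (e′≢f′ ∘ squeeze-cong v v∉e v∉f)
      (punchIn v u , punchIn v w , u≢w ∘ Fin.punchIn-injective v u w ,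
       squeeze-∈⁻ v e v∉e u∈e′ , squeeze-∈⁻ v e v∉e w∈e′ ,
       squeeze-∈⁻ v f v∉f u∈f′ , squeeze-∈⁻ v f v∉f w∈f′)

  delete-crownFree : CrownFree H → CrownFree (delete v H)
  delete-crownFree crownFree (_ , _ , _ , _ , e₁∈ , e₂∈ , e₃∈ , e₄∈ , d₁₂ , d₁₃ , d₂₃ , m₁ , m₂ , m₃)
    with preimage e₁∈ | preimage e₂∈ | preimage e₃∈ | preimage e₄∈
  ... | e₁ , v∉₁ , e₁∈H , refl | e₂ , v∉₂ , e₂∈H , refl | e₃ , v∉₃ , e₃∈H , refl | e₄ , v∉₄ , e₄∈H , refl =
    crownFree (e₁ , e₂ , e₃ , e₄ , e₁∈H , e₂∈H , e₃∈H , e₄∈H ,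
      squeeze-disjoint⁻ v v∉₁ v∉₂ d₁₂ , squeeze-disjoint⁻ v v∉₁ v∉₃ d₁₃ , squeeze-disjoint⁻ v v∉₂ v∉₃ d₂₃ ,
      squeeze-meets⁻ v v∉₄ v∉₁ m₁ , squeeze-meets⁻ v v∉₄ v∉₂ m₂ , squeeze-meets⁻ v v∉₄ v∉₃ m₃)

incident? : ∀ {n} (S : List (Fin n)) (t : Triple n) → Dec (Any (_∈ₑ t) S)
incident? S t = any? (_∈ₑ? t) S

punchOutAll : ∀ {m} {v : Fin (suc m)} (S : List (Fin (suc m))) → All (v ≢_) S → List (Fin m)
punchOutAll []      []            = []
punchOutAll (_ ∷ S) (v≢s ∷ v≢S) = punchOut v≢s ∷ punchOutAll S v≢S

punchOutAll-length : ∀ {m} {v : Fin (suc m)} S (v≢S : All (v ≢_) S) → length (punchOutAll S v≢S) ≡ length S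
punchOutAll-length []      []       = refl
punchOutAll-length (_ ∷ S) (_ ∷ v≢S) = cong suc (punchOutAll-length S v≢S)

punchOutAll-unique : ∀ {m} {v : Fin (suc m)} {S} (v≢S : All (v ≢_) S) →
                     Unique S → Unique (punchOutAll S v≢S)
punchOutAll-unique []            []           = []
punchOutAll-unique (v≢s ∷ v≢S) (s∉S ∷ uS) = fresh v≢S s∉S ∷ punchOutAll-unique v≢S uS
  where
  fresh : ∀ {S′} (v≢S′ : All (_ ≢_) S′) → All (_ ≢_) S′ → All (punchOut v≢s ≢_) (punchOutAll S′ v≢S′)
  fresh []            []            = []
  fresh (v≢s′ ∷ v≢S′) (s≢s′ ∷ s∉S′) = s≢s′ ∘ Fin.punchOut-injective v≢s v≢s′ ∷ fresh v≢S′ s∉S′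

module _ {m : ℕ} {v : Fin (suc m)} where
  open ≡-Reasoning

  incident-squeeze : ∀ {S} (v≢S : All (v ≢_) S) t v∉t →
                     Any (_∈ₑ t) S ⇔ Any (_∈ₑ squeeze v t v∉t) (punchOutAll S v≢S)
  incident-squeeze v≢S t v∉t = mk⇔ (to v≢S) (from v≢S)
    where
    to : ∀ {S} (v≢S : All (v ≢_) S) → Any (_∈ₑ t) S → Any (_∈ₑ squeeze v t v∉t) (punchOutAll S v≢S)
    to (v≢s ∷ _)   (here s∈t)  = here (squeeze-∈⁺ v t v∉t v≢s s∈t)
    to (_ ∷ v≢S) (there s∈t) = there (to v≢S s∈t)
    from : ∀ {S} (v≢S : All (v ≢_) S) → Any (_∈ₑ squeeze v t v∉t) (punchOutAll S v≢S) → Any (_∈ₑ t) S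
    from (v≢s ∷ _)   (here u∈t)  = here (subst (_∈ₑ t) (Fin.punchIn-punchOut v≢s) (squeeze-∈⁻ v t v∉t u∈t))
    from (_ ∷ v≢S) (there u∈t) = there (from v≢S u∈t)

  incident-split : ∀ {S} (v≢S : All (v ≢_) S) ts →
    length (filter (incident? (v ∷ S)) ts) ≡
    length (filter (v ∈ₑ?_) ts) + length (filter (incident? (punchOutAll S v≢S)) (deleteEdges v ts))
  incident-split v≢S [] = refl
  incident-split {S} v≢S (t ∷ ts) with v ∈ₑ? t
  ... | yes v∈t = begin
    length (filter (incident? (v ∷ S)) (t ∷ ts)) ≡⟨ length-accept (incident? (v ∷ S)) (here v∈t) ⟩
    suc (length (filter (incident? (v ∷ S)) ts)) ≡⟨ cong suc (incident-split v≢S ts) ⟩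
    suc (length (filter (v ∈ₑ?_) ts)) + _        ≡⟨ cong (_+ _) (length-accept (v ∈ₑ?_) v∈t) ⟨
    length (filter (v ∈ₑ?_) (t ∷ ts)) + _        ∎
  ... | no v∉t = avoiding (incident? S t)
    where
    S′ = punchOutAll S v≢S
    t′ = squeeze v t v∉t
    avoiding : Dec (Any (_∈ₑ t) S) →
      length (filter (incident? (v ∷ S)) (t ∷ ts)) ≡
      length (filter (v ∈ₑ?_) (t ∷ ts)) + length (filter (incident? S′) (t′ ∷ deleteEdges v ts))
    avoiding (yes t∩S) = begin
      length (filter (incident? (v ∷ S)) (t ∷ ts)) ≡⟨ length-accept (incident? (v ∷ S)) (there t∩S) ⟩
      suc (length (filter (incident? (v ∷ S)) ts)) ≡⟨ cong suc (incident-split v≢S ts) ⟩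
      suc (length (filter (v ∈ₑ?_) ts) + _)        ≡⟨ ℕ.+-suc _ _ ⟨
      length (filter (v ∈ₑ?_) ts) + suc _          ≡⟨ cong₂ _+_ (length-reject (v ∈ₑ?_) v∉t) t′-accepted ⟨
      length (filter (v ∈ₑ?_) (t ∷ ts)) + length (filter (incident? S′) (t′ ∷ deleteEdges v ts)) ∎
      where
      t′-accepted = length-accept (incident? S′) (Equivalence.to (incident-squeeze v≢S t v∉t) t∩S)
    avoiding (no t∌S) = begin
      length (filter (incident? (v ∷ S)) (t ∷ ts)) ≡⟨ length-reject (incident? (v ∷ S)) t∌vS ⟩
      length (filter (incident? (v ∷ S)) ts)       ≡⟨ incident-split v≢S ts ⟩
      length (filter (v ∈ₑ?_) ts) + _              ≡⟨ cong₂ _+_ (length-reject (v ∈ₑ?_) v∉t) t′-rejected ⟨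
      length (filter (v ∈ₑ?_) (t ∷ ts)) + length (filter (incident? S′) (t′ ∷ deleteEdges v ts)) ∎
      where
      t∌vS : ¬ Any (_∈ₑ t) (v ∷ S)
      t∌vS (here v∈t)  = v∉t v∈t
      t∌vS (there t∩S) = t∌S t∩S
      t′-rejected = length-reject (incident? S′) (t∌S ∘ Equivalence.from (incident-squeeze v≢S t v∉t))

record VertexDeletion {n : ℕ} (H : ThreeGraph n) (k lost : ℕ) : Set where
  field
    {order}    : ℕ
    graph      : ThreeGraph order
    order+k    : order + k ≡ n
    linear     : Linear H → Linear graph
    crownFree  : CrownFree H → CrownFree graph
    edges+lost : numEdges graph + lost ≡ numEdges H

deleteVertices : ∀ {n} (H : ThreeGraph n) (S : List (Fin n)) → Unique S →
                 VertexDeletion H (length S) (length (filter (incident? S) (edges H)))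
deleteVertices {n} H [] _ = record
  { graph      = H
  ; order+k    = ℕ.+-identityʳ n
  ; linear     = λ linear → linear
  ; crownFree  = λ crownFree → crownFree
  ; edges+lost = trans (cong (numEdges H +_) (none (edges H))) (ℕ.+-identityʳ _)
  }
  where
  none : ∀ ts → length (filter (incident? []) ts) ≡ 0
  none []       = refl
  none (t ∷ ts) = none ts
deleteVertices {suc m} H (v ∷ S) (v∉S ∷ uS) = record
  { graph      = graph
  ; order+k    = begin
      order + suc (length S)                   ≡⟨ ℕ.+-suc order _ ⟩
      suc (order + length S)                   ≡⟨ cong (λ k → suc (order + k)) (punchOutAll-length S v∉S) ⟨
      suc (order + length (punchOutAll S v∉S)) ≡⟨ cong suc order+k ⟩
      suc m                                    ∎
  ; linear     = linear ∘ delete-linear v H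
  ; crownFree  = crownFree ∘ delete-crownFree v H
  ; edges+lost = begin
      numEdges graph + length (filter (incident? (v ∷ S)) (edges H))
        ≡⟨ cong (numEdges graph +_) (incident-split v∉S (edges H)) ⟩
      numEdges graph + (atV + lostAfter) ≡⟨ cong (numEdges graph +_) (ℕ.+-comm atV lostAfter) ⟩
      numEdges graph + (lostAfter + atV) ≡⟨ ℕ.+-assoc (numEdges graph) lostAfter atV ⟨
      numEdges graph + lostAfter + atV   ≡⟨ cong (_+ atV) edges+lost ⟩
      length (deleteEdges v (edges H)) + atV ≡⟨ deleteEdges-length v (edges H) ⟩
      numEdges H                         ∎
  }
  where
  open ≡-Reasoning
  open VertexDeletion (deleteVertices (delete v H) (punchOutAll S v∉S) (punchOutAll-unique v∉S uS))
  atV = length (filter (v ∈ₑ?_) (edges H))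
  lostAfter = length (filter (incident? (punchOutAll S v∉S)) (deleteEdges v (edges H)))

-- Counting incident edges

Unique⇒lookup-injective : ∀ {X : Set} {xs : List X} → Unique xs → ∀ i j → lookup xs i ≡ lookup xs j → i ≡ j
Unique⇒lookup-injective (_ ∷ _) zero zero _ = refl
Unique⇒lookup-injective {xs = _ ∷ xs} (x∉xs ∷ _) zero (suc j) x≡ =
  contradiction x≡ (All.lookup x∉xs (∈-lookup {xs = xs} j))
Unique⇒lookup-injective {xs = _ ∷ xs} (x∉xs ∷ _) (suc i) zero ≡x =
  contradiction (sym ≡x) (All.lookup x∉xs (∈-lookup {xs = xs} i))
Unique⇒lookup-injective (_ ∷ uxs) (suc i) (suc j) eq = cong suc (Unique⇒lookup-injective uxs i j eq)

length-filter≤codes : ∀ {X : Set} {P : X → Set} (P? : Decidable P) {xs : List X} → Unique xs →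
  ∀ {k} (code : ∀ x → x ∈ xs → P x → Fin k) →
  (∀ {x y} (x∈ : x ∈ xs) (y∈ : y ∈ xs) (px : P x) (py : P y) → code x x∈ px ≡ code y y∈ py → x ≡ y) →
  length (filter P? xs) ≤ k
length-filter≤codes {P = P} P? {xs} uxs {k} code code-injective = ℕ.≮⇒≥ λ k<length →
  let i , j , i<j , same-code = Fin.pigeonhole k<length (λ i → code′ (∈-filter⁻ P? {xs = xs} (∈-lookup i)))
  in Fin.<⇒≢ i<j (Unique⇒lookup-injective (Unique.filter⁺ P? uxs) i j (code-injective _ _ _ _ same-code))
  where
  code′ : ∀ {y} → y ∈ xs × P y → Fin k
  code′ (y∈ , py) = code _ y∈ py

join-injective : ∀ m n {x y : Fin m ⊎ Fin n} → join m n x ≡ join m n y → x ≡ y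
join-injective m n {x} {y} eq =
  trans (sym (Fin.splitAt-join m n x)) (trans (cong (splitAt m) eq) (Fin.splitAt-join m n y))

counterexample-after-deletion : ∀ {n m k E E′ lost} → m + k ≡ n → E′ + lost ≡ E →
  2 * lost ≤ 3 * k → 3 * n < 2 * E → 3 * m < 2 * E′
counterexample-after-deletion {m = m} {k} {E′ = E′} {lost} refl refl lost≤ dense =
  ℕ.+-cancelʳ-< (3 * k) (3 * m) (2 * E′) (begin-strict
    3 * m + 3 * k     ≡⟨ ℕ.*-distribˡ-+ 3 m k ⟨
    3 * (m + k)       <⟨ dense ⟩
    2 * (E′ + lost)   ≡⟨ ℕ.*-distribˡ-+ 2 E′ lost ⟩
    2 * E′ + 2 * lost ≤⟨ ℕ.+-monoʳ-≤ (2 * E′) lost≤ ⟩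
    2 * E′ + 3 * k    ∎)
  where open ℕ.≤-Reasoning

minimal⇒incident-dense : ∀ {n} {H : ThreeGraph n} → MinimalCounterexample H →
  (S : List (Fin n)) → Unique S → 0 < length S → 3 * length S < 2 * length (filter (incident? S) (edges H))
minimal⇒incident-dense {H = H} ((linear′ , crownFree′ , dense) , minimal) S uS nonempty =
  ℕ.≰⇒> λ sparse → minimal order smaller graph
    (linear linear′ , crownFree crownFree′ ,
     counterexample-after-deletion {k = length S} {E′ = numEdges graph} order+k edges+lost sparse dense)
  where
  open VertexDeletion (deleteVertices H S uS)
  smaller : order < _
  smaller = subst (order <_) order+k (ℕ.m<m+n order nonempty)

-- The configuration around a bad edge

Label : Set
Label = Fin 11

pattern A  = zero
pattern B  = suc A
pattern C  = suc B
pattern U₁ = suc C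
pattern U₂ = suc U₁
pattern U₃ = suc U₂
pattern U₄ = suc U₃
pattern W₁ = suc U₄
pattern W₂ = suc W₁
pattern W₃ = suc W₂
pattern W₄ = suc W₃

-- Template edge 0 is e = {a, b, c}; the others are the edges {x, y, z} of H that produce the
-- coloured edges {x, y} of colour z of G(e) ≅ G₆.
templateEdges : List (Triple 11)
templateEdges = (A , B , C) ∷ G6Edges A B C U₁ U₂ U₃ U₄ W₁ W₂ W₃ W₄

template : Fin 9 → Triple 11
template = lookup templateEdges

diagonal : Fin 4 → Label × Label
diagonal = lookup ((U₁ , U₃) ∷ (U₂ , U₄) ∷ (W₁ , W₃) ∷ (W₂ , W₄) ∷ [])

opaque
  template-distinct : ∀ j → Distinct (template j)
  template-distinct = from-yes (Fin.all? {9} λ j → let (p , q , r) = template j in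
    ¬? (p ≟ q) ×-dec ¬? (p ≟ r) ×-dec ¬? (q ≟ r))

  diagonal-distinct : ∀ d → proj₁ (diagonal d) ≢ proj₂ (diagonal d)
  diagonal-distinct = from-yes (Fin.all? {4} λ d → ¬? (proj₁ (diagonal d) ≟ proj₂ (diagonal d)))

-- The trace of an edge f on the labelled vertices: σ ∋ k holds iff f contains vertex k.
Trace : Set
Trace = Vec Bool 11

_∋_ : Trace → Label → Bool
_∋_ = Vec.lookup

_∈ᵇ_ : Label → Triple 11 → Bool
k ∈ᵇ t = ⌊ k ∈ₑ? t ⌋

∈ᵇ-sound : ∀ {k t} → T (k ∈ᵇ t) → k ∈ₑ t
∈ᵇ-sound {k} {t} = toWitness {a? = k ∈ₑ? t}

∈ᵇ-complete : ∀ {k t} → k ∈ₑ t → T (k ∈ᵇ t)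
∈ᵇ-complete {k} {t} = fromWitness {a? = k ∈ₑ? t}

anyOf : (Label → Bool) → Triple 11 → Bool
anyOf P (p , q , r) = P p ∨ P q ∨ P r

atLeastTwo : Trace → Triple 11 → Bool
atLeastTwo σ (p , q , r) = (σ ∋ p ∧ σ ∋ q) ∨ (σ ∋ p ∧ σ ∋ r) ∨ (σ ∋ q ∧ σ ∋ r)

-- A crown certificate (c , i , j) says that the
-- edge is disjoint from the template edges i and j, which are disjoint from each other, while the
-- template edge c meets all three; such an edge cannot exist in a crown-free H.
data Certificate : Set where
  sharesPairWith   : Fin 9 → Certificate
  containsDiagonal : Fin 4 → Certificate
  completesCrown   : Triple 9 → Certificate

holds : Trace → Certificate → Bool
holds σ (sharesPairWith j)   = atLeastTwo σ (template j)
holds σ (containsDiagonal d) = σ ∋ proj₁ (diagonal d) ∧ σ ∋ proj₂ (diagonal d)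
holds σ (completesCrown (c , i , j)) =
  not (anyOf (_∈ᵇ template j) (template i)) ∧
  anyOf (_∈ᵇ template i) (template c) ∧ anyOf (_∈ᵇ template j) (template c) ∧
  anyOf (σ ∋_) (template c) ∧ not (anyOf (σ ∋_) (template i)) ∧ not (anyOf (σ ∋_) (template j))

certificates : List Certificate
certificates =
  List.tabulate sharesPairWith ++ List.tabulate containsDiagonal ++
  List.map completesCrown
    ( (# 0 , # 1 , # 3) ∷ (# 1 , # 4 , # 5) ∷ (# 1 , # 2 , # 5) ∷ (# 3 , # 4 , # 6) ∷ (# 3 , # 2 , # 8)
    ∷ (# 8 , # 3 , # 7) ∷ (# 6 , # 3 , # 7) ∷ (# 7 , # 1 , # 8) ∷ (# 3 , # 2 , # 6) ∷ (# 7 , # 1 , # 6)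
    ∷ (# 3 , # 4 , # 8) ∷ (# 0 , # 2 , # 5) ∷ (# 0 , # 2 , # 6) ∷ [])

covered : Trace → Bool
covered σ = not (any (σ ∋_) (allFin 11)) ∨ any (holds σ) certificates

every : ∀ k → (Vec Bool k → Bool) → Bool
every zero    P = P []
every (suc k) P = every k (P ∘ (true ∷_)) ∧ every k (P ∘ (false ∷_))

every-sound : ∀ k P → T (every k P) → ∀ σ → T (P σ)
every-sound zero    P h []          = h
every-sound (suc k) P h (true ∷ σ)  = every-sound k (P ∘ (true ∷_)) (proj₁ (Equivalence.to T-∧ h)) σ
every-sound (suc k) P h (false ∷ σ) =
  every-sound k (P ∘ (false ∷_)) (proj₂ (Equivalence.to (T-∧ {every k (P ∘ (true ∷_))}) h)) σ

-- Checked by evaluating over all 2¹¹ traces.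
opaque
  every-trace-covered : ∀ σ → T (covered σ)
  every-trace-covered = every-sound 11 covered _

anyOf-sound : ∀ P t → T (anyOf P t) → ∃[ k ] k ∈ₑ t × T (P k)
anyOf-sound P (p , q , r) h with Equivalence.to T-∨ h
... | inj₁ Pp = p , inj₁ refl , Pp
... | inj₂ h′ with Equivalence.to T-∨ h′
...   | inj₁ Pq = q , inj₂ (inj₁ refl) , Pq
...   | inj₂ Pr = r , inj₂ (inj₂ refl) , Pr

anyOf-complete : ∀ P t {k} → k ∈ₑ t → T (P k) → T (anyOf P t)
anyOf-complete P (p , q , r) (inj₁ refl)        Pk = Equivalence.from T-∨ (inj₁ Pk)
anyOf-complete P (p , q , r) (inj₂ (inj₁ refl)) Pk =
  Equivalence.from (T-∨ {P p}) (inj₂ (Equivalence.from T-∨ (inj₁ Pk)))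
anyOf-complete P (p , q , r) (inj₂ (inj₂ refl)) Pk =
  Equivalence.from (T-∨ {P p}) (inj₂ (Equivalence.from (T-∨ {P q}) (inj₂ Pk)))

atLeastTwo-sound : ∀ σ t → Distinct t → T (atLeastTwo σ t) →
                   ∃₂ λ k l → k ≢ l × k ∈ₑ t × l ∈ₑ t × T (σ ∋ k) × T (σ ∋ l)
atLeastTwo-sound σ (p , q , r) (p≢q , p≢r , q≢r) h with Equivalence.to T-∨ h
... | inj₁ pq = p , q , p≢q , inj₁ refl , inj₂ (inj₁ refl) , Equivalence.to T-∧ pq
... | inj₂ h′ with Equivalence.to T-∨ h′
...   | inj₁ pr = p , r , p≢r , inj₁ refl , inj₂ (inj₂ refl) , Equivalence.to T-∧ pr
...   | inj₂ qr = q , r , q≢r , inj₂ (inj₁ refl) , inj₂ (inj₂ refl) , Equivalence.to T-∧ qr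

T-not : ∀ {x} → T (not x) → ¬ T x
T-not {false} _ ()

implied : ∀ {x y} → T (not x ∨ y) → T x → T y
implied {true} y _ = y

module Realisation {n} {H : ThreeGraph n} (linear : Linear H) (crownFree : CrownFree H)
  (φ : Label → Fin n) (φ-injective : Injective _≡_ _≡_ φ)
  (realised : All (EdgeOver H ∘ map₃ φ) templateEdges) where

  edgeOf : Fin 9 → Triple n
  edgeOf j = proj₁ (All.lookup realised (∈-lookup j))

  edgeOf∈ : ∀ j → edgeOf j ∈ edges H
  edgeOf∈ j = proj₁ (proj₂ (All.lookup realised (∈-lookup j)))

  edgeOf-⊇ : ∀ j → map₃ φ (template j) ⊆ₑ edgeOf j
  edgeOf-⊇ j = proj₂ (proj₂ (All.lookup realised (∈-lookup j)))

  edgeOf-vertex : ∀ j {w} → w ∈ₑ edgeOf j → ∃[ k ] k ∈ₑ template j × w ≡ φ k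
  edgeOf-vertex j w∈ =
    map₃-∈⁻ φ (template j) (⊆ₑ-reverse (map₃-distinct φ-injective (template-distinct j)) (edgeOf-⊇ j) w∈)

  edgeOf-∈⁺ : ∀ j {k} → k ∈ₑ template j → φ k ∈ₑ edgeOf j
  edgeOf-∈⁺ j k∈ = edgeOf-⊇ j (map₃-∈⁺ φ k∈)

  edgeOf-∈⁻ : ∀ j {k} → φ k ∈ₑ edgeOf j → k ∈ₑ template j
  edgeOf-∈⁻ j φk∈ =
    let l , l∈ , φk≡φl = edgeOf-vertex j φk∈ in subst (_∈ₑ template j) (sym (φ-injective φk≡φl)) l∈

  traceOf : Triple n → Trace
  traceOf f = Vec.tabulate λ k → ⌊ φ k ∈ₑ? f ⌋

  traceOf-sound : ∀ f {k} → T (traceOf f ∋ k) → φ k ∈ₑ f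
  traceOf-sound f {k} h =
    toWitness {a? = φ k ∈ₑ? f} (subst T (Vec.lookup∘tabulate (λ k → ⌊ φ k ∈ₑ? f ⌋) k) h)

  traceOf-complete : ∀ f {k} → φ k ∈ₑ f → T (traceOf f ∋ k)
  traceOf-complete f {k} φk∈f =
    subst T (sym (Vec.lookup∘tabulate (λ k → ⌊ φ k ∈ₑ? f ⌋) k)) (fromWitness {a? = φ k ∈ₑ? f} φk∈f)

  edgeOf-avoids : ∀ P j → T (not (anyOf P (template j))) →
                  ∀ {w} → w ∈ₑ edgeOf j → ∃[ k ] w ≡ φ k × ¬ T (P k)
  edgeOf-avoids P j h w∈ =
    let k , k∈ , w≡ = edgeOf-vertex j w∈ in k , w≡ , T-not h ∘ anyOf-complete P (template j) k∈

  edgeOf-witness : ∀ P j → T (anyOf P (template j)) → ∃[ k ] φ k ∈ₑ edgeOf j × T (P k)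
  edgeOf-witness P j h = let k , k∈ , Pk = anyOf-sound P (template j) h in k , edgeOf-∈⁺ j k∈ , Pk

  edgeOf-disjoint : ∀ i j → T (not (anyOf (_∈ᵇ template j) (template i))) → Disjoint (edgeOf i) (edgeOf j)
  edgeOf-disjoint i j h w w∈i w∈j with edgeOf-avoids (_∈ᵇ template j) i h w∈i
  ... | k , refl , k∉j = k∉j (∈ᵇ-complete {k} {template j} (edgeOf-∈⁻ j w∈j))

  edgeOf-meets : ∀ c i → T (anyOf (_∈ᵇ template i) (template c)) → Meets (edgeOf c) (edgeOf i)
  edgeOf-meets c i h =
    let k , k∈c , k∈i = edgeOf-witness (_∈ᵇ template i) c h in φ k , k∈c , edgeOf-∈⁺ i (∈ᵇ-sound k∈i)

  trace-disjoint : ∀ {f} j → T (not (anyOf (traceOf f ∋_) (template j))) → Disjoint f (edgeOf j)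
  trace-disjoint {f} j h w w∈f w∈j =
    let k , w≡ , k∉f = edgeOf-avoids (traceOf f ∋_) j h w∈j
    in k∉f (traceOf-complete f (subst (_∈ₑ f) w≡ w∈f))

  trace-meets : ∀ {f} c → T (anyOf (traceOf f ∋_) (template c)) → Meets (edgeOf c) f
  trace-meets {f} c h =
    let k , k∈c , k∈f = edgeOf-witness (traceOf f ∋_) c h in φ k , k∈c , traceOf-sound f k∈f

  sharedPair⇒edgeOf : ∀ {f} j → f ∈ edges H → T (atLeastTwo (traceOf f) (template j)) → f ≡ edgeOf j
  sharedPair⇒edgeOf {f} j f∈ h =
    let k , l , k≢l , k∈ , l∈ , k∈f , l∈f =
          atLeastTwo-sound (traceOf f) (template j) (template-distinct j) h
    in shareTwo⇒≡ {H = H} linear {u = φ k} {φ l} f∈ (edgeOf∈ j) (k≢l ∘ φ-injective)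
         (traceOf-sound f k∈f) (traceOf-sound f l∈f) (edgeOf-∈⁺ j k∈) (edgeOf-∈⁺ j l∈)

  crown-impossible : ∀ {f} c i j → f ∈ edges H → ¬ T (holds (traceOf f) (completesCrown (c , i , j)))
  crown-impossible {f} c i j f∈ h =
    let dᵢⱼ , h = split h ; mᵢ , h = split h ; mⱼ , h = split h ; mf , h = split h ; dᵢ , dⱼ = split h
    in crownFree (f , edgeOf i , edgeOf j , edgeOf c , f∈ , edgeOf∈ i , edgeOf∈ j , edgeOf∈ c ,
                  trace-disjoint i dᵢ , trace-disjoint j dⱼ , edgeOf-disjoint i j dᵢⱼ ,
                  trace-meets c mf , edgeOf-meets c i mᵢ , edgeOf-meets c j mⱼ)
    where
    split : ∀ {x y} → T (x ∧ y) → T x × T y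
    split = Equivalence.to T-∧

  data Explained (f : Triple n) : Set where
    templateEdge    : (j : Fin 9) → f ≡ edgeOf j → Explained f
    throughDiagonal : (d : Fin 4) → φ (proj₁ (diagonal d)) ∈ₑ f → φ (proj₂ (diagonal d)) ∈ₑ f → Explained f

  explain : ∀ {f} → f ∈ edges H → Any (_∈ₑ f) (List.tabulate φ) → Explained f
  explain {f} f∈ hit =
    let k , φk∈f = Any.tabulate⁻ {f = φ} hit
        nonempty = Any.any⁺ (traceOf f ∋_) (Any.map (λ { refl → traceOf-complete f {k} φk∈f }) (∈-allFin k))
        certified = implied {any (traceOf f ∋_) (allFin 11)} (every-trace-covered (traceOf f)) nonempty
        c , holds-c = Any.satisfied (Any.any⁻ (holds (traceOf f)) certificates certified)
    in fromCertificate c holds-c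
    where
    fromCertificate : ∀ c → T (holds (traceOf f) c) → Explained f
    fromCertificate (sharesPairWith j)     h = templateEdge j (sharedPair⇒edgeOf j f∈ h)
    fromCertificate (containsDiagonal d)   h =
      let x∈ , y∈ = Equivalence.to T-∧ h in throughDiagonal d (traceOf-sound f x∈) (traceOf-sound f y∈)
    fromCertificate (completesCrown (c , i , j)) h = ⊥-elim (crown-impossible c i j f∈ h)

  code : ∀ {f} → Explained f → Fin 9 ⊎ Fin 4
  code (templateEdge j _)      = inj₁ j
  code (throughDiagonal d _ _) = inj₂ d

  code-injective : ∀ {f g} → f ∈ edges H → g ∈ edges H →
                   (x : Explained f) (y : Explained g) → code x ≡ code y → f ≡ g
  code-injective _  _  (templateEdge j f≡)          (templateEdge .j g≡)         refl = trans f≡ (sym g≡)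
  code-injective f∈ g∈ (throughDiagonal d x∈f y∈f) (throughDiagonal .d x∈g y∈g) refl =
    shareTwo⇒≡ {H = H} linear f∈ g∈ (diagonal-distinct d ∘ φ-injective) x∈f y∈f x∈g y∈g
  code-injective _ _ (templateEdge _ _)      (throughDiagonal _ _ _) ()
  code-injective _ _ (throughDiagonal _ _ _) (templateEdge _ _)      ()

  incident≤13 : length (filter (incident? (List.tabulate φ)) (edges H)) ≤ 13
  incident≤13 = length-filter≤codes (incident? (List.tabulate φ)) (unique H)
    (λ f f∈ hit → join 9 4 (code (explain f∈ hit)))
    (λ f∈ g∈ hit-f hit-g same →
       code-injective f∈ g∈ (explain f∈ hit-f) (explain g∈ hit-g) (join-injective 9 4 same))

badEdge⇒sparseSet : ∀ {n} {H : ThreeGraph n} → Linear H → CrownFree H → BadEdge H →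
  ∃[ S ] Unique S × length S ≡ 11 × length (filter (incident? S) (edges H)) ≤ 13
badEdge⇒sparseSet {n} {H} linear crownFree
  (e , a , b , c , e∈ , a∈e , b∈e , c∈e , a≢b , a≢c , b≢c , _ , _ , _ ,
   u₁ , u₂ , u₃ , u₄ , w₁ , w₂ , w₃ , w₄ , us-unique , link⇔) =
  vertices , vertices-unique , refl ,
  Realisation.incident≤13 {H = H} linear crownFree φ φ-injective realised
  where
  us = u₁ ∷ u₂ ∷ u₃ ∷ u₄ ∷ w₁ ∷ w₂ ∷ w₃ ∷ w₄ ∷ []
  vertices = a ∷ b ∷ c ∷ us

  links : All (λ (x , y , z) → LinkEdge H e x y z) (G6Edges a b c u₁ u₂ u₃ u₄ w₁ w₂ w₃ w₄)
  links = All.tabulate λ t∈ → Equivalence.from (link⇔ _ _ _) (inj₁ t∈)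

  outside : All (λ v → ¬ v ∈ₑ e) us
  outside with links
  ... | l₁ ∷ l₂ ∷ l₃ ∷ _ ∷ l₅ ∷ l₆ ∷ l₇ ∷ _ ∷ [] =
    proj₁ (ends l₁) ∷ proj₂ (ends l₁) ∷ proj₂ (ends l₂) ∷ proj₂ (ends l₃) ∷
    proj₁ (ends l₅) ∷ proj₂ (ends l₅) ∷ proj₂ (ends l₆) ∷ proj₂ (ends l₇) ∷ []
    where
    ends : ∀ {x y z} → LinkEdge H e x y z → ¬ x ∈ₑ e × ¬ y ∈ₑ e
    ends = linkEdge-ends∉ {H = H} linear e∈

  apart : ∀ {x} → x ∈ₑ e → All (x ≢_) us
  apart x∈e = All.map (λ v∉e x≡v → v∉e (subst (_∈ₑ e) x≡v x∈e)) outside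

  vertices-unique : Unique vertices
  vertices-unique = (a≢b ∷ a≢c ∷ apart a∈e) ∷ (b≢c ∷ apart b∈e) ∷ apart c∈e ∷ us-unique

  -- List.tabulate φ computes to vertices, so incident≤13 is about vertices.
  φ : Label → Fin n
  φ = lookup vertices

  φ-injective : Injective _≡_ _≡_ φ
  φ-injective {k} {l} = Unique⇒lookup-injective vertices-unique k l

  realised : All (EdgeOver H ∘ map₃ φ) templateEdges
  realised = (e , e∈ , ⊆ₑ-intro a∈e b∈e c∈e) ∷ All.map⁻ (All.map (linkEdge⇒edgeOver {H = H} {e = e}) links)

mainTheorem7 : (n : ℕ) (H : ThreeGraph n) → MinimalCounterexample H → ¬ BadEdge H
mainTheorem7 n H minimal@((linear , crownFree , _) , _) bad =
  let S , S-unique , |S|≡11 , sparse = badEdge⇒sparseSet {H = H} linear crownFree bad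
      dense = minimal⇒incident-dense {H = H} minimal S S-unique (subst (0 <_) (sym |S|≡11) (s≤s z≤n))
  in ℕ.<⇒≱ dense (begin
       2 * length (filter (incident? S) (edges H)) ≤⟨ ℕ.*-monoʳ-≤ 2 sparse ⟩
       26                                          ≤⟨ ℕ.m≤m+n 26 7 ⟩
       3 * 11                                      ≡⟨ cong (3 *_) |S|≡11 ⟨
       3 * length S                                ∎)
  where open ℕ.≤-Reasoning
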